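{- Let $G$ be a graph with $n$ vertices and $H$ a graph with $m$ vertices, where $4\leq n\leq m\leq 2n$. Then $D'(G+H)\leq 2$.
   Context: The join $G+H$ of graphs on disjoint vertex sets has as edges all edges of $G$, all edges of $H$, and all pairs with one end in $V(G)$ and the other in $V(H)$. The distinguishing index $D'(X)$ is the least $d$ such that $X$ has an edge colouring with $d$ colours preserved by no non-identity automorphism of $X$. -}

module Defs where

open import Data.Nat using (ℕ; _+_)
open import Data.Bool using (Bool; true; false)
open import Data.Fin using (Fin; _↑ˡ_; _↑ʳ_; splitAt)
open import Data.Sum using (_⊎_; inj₁; inj₂)
open import Data.Product using (_×_; Σ; _,_)
open import Relation.Binary.PropositionalEquality using (_≡_; refl)
open import Function.Bundles using (_↔_; Inverse)

record Graph (n : ℕ) : Set where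
  field
    adj   : Fin n → Fin n → Bool
    sym   : ∀ u v → adj u v ≡ adj v u
    irrefl : ∀ u → adj u u ≡ false
open Graph public

joinAdj : ∀ {n m} → Graph n → Graph m → Fin (n + m) → Fin (n + m) → Bool
joinAdj {n} G H u v with splitAt n u | splitAt n v
... | inj₁ a | inj₁ b = adj G a b
... | inj₂ a | inj₂ b = adj H a b
... | inj₁ _ | inj₂ _ = true
... | inj₂ _ | inj₁ _ = true

joinAdj-sym : ∀ {n m} (G : Graph n) (H : Graph m) u v → joinAdj G H u v ≡ joinAdj G H v u
joinAdj-sym {n} G H u v with splitAt n u | splitAt n v
... | inj₁ a | inj₁ b = sym G a b
... | inj₂ a | inj₂ b = sym H a b
... | inj₁ _ | inj₂ _ = refl
... | inj₂ _ | inj₁ _ = refl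

joinAdj-irrefl : ∀ {n m} (G : Graph n) (H : Graph m) u → joinAdj G H u u ≡ false
joinAdj-irrefl {n} G H u with splitAt n u
... | inj₁ a = irrefl G a
... | inj₂ a = irrefl H a

join : ∀ {n m} → Graph n → Graph m → Graph (n + m)
join G H = record { adj = joinAdj G H ; sym = joinAdj-sym G H ; irrefl = joinAdj-irrefl G H }

Edge : ∀ {n} → Graph n → Fin n → Fin n → Set
Edge G u v = adj G u v ≡ true

record Automorphism {n} (G : Graph n) : Set where
  field
    perm : Fin n ↔ Fin n
    preserves : ∀ u v → adj G (Inverse.to perm u) (Inverse.to perm v) ≡ adj G u v
open Automorphism public

-- An edge colouring with d colours: a symmetric assignment of a colour to each
-- pair; only its values on edges matter.
record EdgeColouring {n} (G : Graph n) (d : ℕ) : Set where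
  field
    col : Fin n → Fin n → Fin d
    col-sym : ∀ u v → col u v ≡ col v u
open EdgeColouring public

PreservesColouring : ∀ {n d} {G : Graph n} → Automorphism G → EdgeColouring G d → Set
PreservesColouring {G = G} σ c =
  ∀ u v → Edge G u v → col c (Inverse.to (perm σ) u) (Inverse.to (perm σ) v) ≡ col c u v

Distinguishing : ∀ {n d} {G : Graph n} → EdgeColouring G d → Set
Distinguishing {G = G} c =
  (σ : Automorphism G) → PreservesColouring σ c → ∀ u → Inverse.to (perm σ) u ≡ u

DistIndex≤ : ∀ {n} → Graph n → ℕ → Set
DistIndex≤ G d = Σ (EdgeColouring G d) Distinguishing

module Submission where

-- Write n = 4 + n₀ (so L = n - 1 ≥ 3) and m = n + k with k ≤ n.  Call the
-- vertices of G  A₀ … A_L  and those of H  B₀ … B_L, C₀ … C_{k-1}.  Colour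
-- red the following edges of G + H, all of which run between G and H:
--   the path A₀ B₀ A₁ B₁ … B_{L-1} A_L,  the edges A₁B_L, A₂B_L, A_LB_L,
--   and the pendant edges A_t C_t;
-- every other edge is blue.  An automorphism of G + H preserving this
-- colouring is an automorphism of the red graph, and the red graph is
-- asymmetric, so the colouring is distinguishing.

open import Defs
open import Data.Nat using (ℕ; _+_; _≤_; _*_)
open import Data.Nat using (zero; suc; pred; _<_; s≤s; z≤n; z<s)
open import Data.Nat.Properties
  using (_≟_; _<?_; <⇒≤; ≤∧≢⇒<; <-irrefl; +-cancelˡ-≤; +-identityʳ; m≤n⇒∃[o]m+o≡n; ≤-trans; n<1+n)
open import Data.Fin using (Fin; toℕ; fromℕ<; _↑ˡ_; _↑ʳ_; splitAt)
open import Data.Fin.Patterns using (0F; 1F)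
open import Data.Fin.Properties
  using (toℕ<n; toℕ-fromℕ<; fromℕ<-toℕ; splitAt-↑ˡ; splitAt-↑ʳ; splitAt⁻¹-↑ˡ; splitAt⁻¹-↑ʳ)
open import Data.Bool using (Bool; true; false)
open import Data.Empty using (⊥; ⊥-elim)
import Data.Empty.Irrelevant as Irrelevant
open import Data.Unit using (⊤; tt)
open import Data.Product using (∃; ∃₂; _×_; _,_)
open import Data.Sum using (_⊎_; inj₁; inj₂; [_,_]′)
import Data.Sum as Sum
open import Function using (_∘_)
open import Function.Bundles using (_↔_; Inverse; _⇔_; Equivalence; mk⇔; mk↔ₛ′)
open import Function.Construct.Composition using (_↔-∘_)
open import Function.Construct.Symmetry using (↔-sym)
open import Relation.Nullary using (¬_; Dec; yes; no; does)
open import Relation.Nullary.Decidable using (dec-true; dec-false)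
open import Relation.Binary.PropositionalEquality
  using (_≡_; _≢_; refl; trans; cong; cong₂; subst; module ≡-Reasoning)
import Relation.Binary.PropositionalEquality as ≡

open Inverse using (to; from; strictlyInverseˡ; strictlyInverseʳ)

Asymmetric : ∀ {n} → Graph n → Set
Asymmetric R = (σ : Automorphism R) → ∀ u → to (perm σ) u ≡ u

_⊆_ : ∀ {n} → Graph n → Graph n → Set
R ⊆ X = ∀ u v → Edge R u v → Edge X u v

-- Red (true) is colour 1, blue (false) colour 0.
bit : Bool → Fin 2
bit false = 0F
bit true  = 1F

bit-injective : ∀ {a b} → bit a ≡ bit b → a ≡ b
bit-injective {false} {false} _ = refl
bit-injective {true}  {true}  _ = refl
bit-injective {false} {true}  ()
bit-injective {true}  {false} ()

membership : ∀ {n} (X R : Graph n) → EdgeColouring X 2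
membership X R = record
  { col     = λ u v → bit (adj R u v)
  ; col-sym = λ u v → cong bit (sym R u v) }

-- An automorphism of X preserving the membership colouring of R ⊆ X
-- preserves adjacency in R: edges of R stay in R by the colouring, and
-- non-edges of R stay outside R because σ⁻¹ preserves edges of X.
restrict : ∀ {n} {X R : Graph n} → R ⊆ X → (σ : Automorphism X) →
           PreservesColouring σ (membership X R) → Automorphism R
restrict {X = X} {R} R⊆X σ keeps = record { perm = perm σ ; preserves = preservesR }
  where
    f = to (perm σ)
    preservesR : ∀ u v → adj R (f u) (f v) ≡ adj R u v
    preservesR u v with adj R u v in uv
    ... | true = bit-injective (trans (keeps u v (R⊆X u v uv)) (cong bit uv))
    ... | false with adj R (f u) (f v) in fuv
    ...   | false = refl
    ...   | true  = bit-injective (trans (cong bit (≡.sym fuv))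
                                    (trans (keeps u v uvX) (cong bit uv)))
      where uvX : Edge X u v
            uvX = trans (≡.sym (preserves σ u v)) (R⊆X (f u) (f v) fuv)

asymmetric-subgraph⇒D′≤2 : ∀ {n} (X R : Graph n) → R ⊆ X → Asymmetric R → DistIndex≤ X 2
asymmetric-subgraph⇒D′≤2 X R R⊆X asym =
  membership X R , λ σ keeps → asym (restrict R⊆X σ keeps)

module _ {V : Set} (_∼_ : V → V → Set) where

  IsAutomorphism : V ↔ V → Set
  IsAutomorphism ρ = ∀ x y → x ∼ y ⇔ to ρ x ∼ to ρ y

  Rigid : Set
  Rigid = ∀ ρ → IsAutomorphism ρ → ∀ x → to ρ x ≡ x

does-sound : ∀ {P : Set} (d : Dec P) → does d ≡ true → P
does-sound (yes p) _ = p
does-sound (no _) ()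

same-does⇒⇔ : ∀ {P Q : Set} (d : Dec P) (e : Dec Q) → does d ≡ does e → P ⇔ Q
same-does⇒⇔ d e d≡e = mk⇔ (λ p → does-sound e (trans (≡.sym d≡e) (dec-true d p)))
                           (λ q → does-sound d (trans d≡e (dec-true e q)))

-- A decidable symmetric irreflexive relation on a type V, transported along
-- a bijection ι : Fin n ↔ V, is a graph on Fin n; it is asymmetric when the
-- relation is rigid, since an automorphism σ conjugates to ι ∘ σ ∘ ι⁻¹.
module Pullback {n} {V : Set} (ι : Fin n ↔ V) {_∼_ : V → V → Set}
  (∼-sym : ∀ {x y} → x ∼ y → y ∼ x) (∼-irrefl : ∀ {x} → ¬ x ∼ x)
  (_∼?_ : ∀ x y → Dec (x ∼ y)) where

  related : V → V → Bool
  related x y = does (x ∼? y)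

  related-sym : ∀ x y → related x y ≡ related y x
  related-sym x y with x ∼? y
  ... | yes xy = ≡.sym (dec-true (y ∼? x) (∼-sym xy))
  ... | no ¬xy = ≡.sym (dec-false (y ∼? x) (¬xy ∘ ∼-sym))

  graph : Graph n
  graph = record
    { adj    = λ u v → related (to ι u) (to ι v)
    ; sym    = λ u v → related-sym (to ι u) (to ι v)
    ; irrefl = λ u → dec-false (to ι u ∼? to ι u) ∼-irrefl }

  edge-sound : ∀ {u v} → Edge graph u v → to ι u ∼ to ι v
  edge-sound {u} {v} = does-sound (to ι u ∼? to ι v)

  rigid⇒asymmetric : Rigid _∼_ → Asymmetric graph
  rigid⇒asymmetric rigid σ u = begin
    s u                       ≡⟨ cong s (≡.sym (strictlyInverseʳ ι u)) ⟩
    s (from ι (to ι u))       ≡⟨ ≡.sym (strictlyInverseʳ ι _) ⟩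
    from ι (to ρ (to ι u))    ≡⟨ cong (from ι) (rigid ρ automorphism (to ι u)) ⟩
    from ι (to ι u)           ≡⟨ strictlyInverseʳ ι u ⟩
    u                         ∎
    where
      open ≡-Reasoning
      s = to (perm σ)
      ρ : V ↔ V
      ρ = ι ↔-∘ (perm σ ↔-∘ ↔-sym ι)
      ι-cancel : ∀ x y → related (to ι (from ι x)) (to ι (from ι y)) ≡ related x y
      ι-cancel x y = cong₂ related (strictlyInverseˡ ι x) (strictlyInverseˡ ι y)
      automorphism : IsAutomorphism _∼_ ρ
      automorphism x y = same-does⇒⇔ (x ∼? y) (to ρ x ∼? to ρ y)
        (≡.sym (trans (preserves σ (from ι x) (from ι y)) (ι-cancel x y)))

module Degrees {V : Set} (_∼_ : V → V → Set) where

  Degree₁ : V → Set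
  Degree₁ x = ∃ λ y → x ∼ y × (∀ z → x ∼ z → z ≡ y)

  Degree₂ : V → Set
  Degree₂ x = ∃₂ λ y z → y ≢ z × x ∼ y × x ∼ z × (∀ w → x ∼ w → w ≡ y ⊎ w ≡ z)

  two⇒¬degree₁ : ∀ {x a b} → x ∼ a → x ∼ b → a ≢ b → ¬ Degree₁ x
  two⇒¬degree₁ xa xb a≢b (_ , _ , only) = a≢b (trans (only _ xa) (≡.sym (only _ xb)))

  degree₁⇒¬degree₂ : ∀ {x} → Degree₁ x → ¬ Degree₂ x
  degree₁⇒¬degree₂ d₁ (_ , _ , y≢z , xy , xz , _) = two⇒¬degree₁ xy xz y≢z d₁

  three⇒¬degree₂ : ∀ {x a b c} → x ∼ a → x ∼ b → x ∼ c →
                   a ≢ b → a ≢ c → b ≢ c → ¬ Degree₂ x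
  three⇒¬degree₂ xa xb xc a≢b a≢c b≢c (_ , _ , _ , _ , _ , only)
    with only _ xa | only _ xb | only _ xc
  ... | inj₁ refl | inj₁ refl | _         = a≢b refl
  ... | inj₂ refl | inj₂ refl | _         = a≢b refl
  ... | inj₁ refl | inj₂ refl | inj₁ refl = a≢c refl
  ... | inj₁ refl | inj₂ refl | inj₂ refl = b≢c refl
  ... | inj₂ refl | inj₁ refl | inj₁ refl = b≢c refl
  ... | inj₂ refl | inj₁ refl | inj₂ refl = a≢c refl

  module Invariance (ρ : V ↔ V) (automorphism : IsAutomorphism _∼_ ρ) where

    Fixed : V → Set
    Fixed x = to ρ x ≡ x

    Invariant : (V → Set) → Set
    Invariant Q = ∀ {x} → Q x → Q (to ρ x)

    private
      p = to ρ
      q = from ρ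

      preserve : ∀ {x y} → x ∼ y → p x ∼ p y
      preserve {x} {y} = Equivalence.to (automorphism x y)

      reflect : ∀ {x y} → p x ∼ y → x ∼ q y
      reflect {x} {y} pxy =
        Equivalence.from (automorphism x (q y)) (subst (p x ∼_) (≡.sym (strictlyInverseˡ ρ y)) pxy)

      p-injective : ∀ {x y} → p x ≡ p y → x ≡ y
      p-injective {x} {y} px≡py =
        trans (≡.sym (strictlyInverseʳ ρ x)) (trans (cong q px≡py) (strictlyInverseʳ ρ y))

      moved : ∀ {y z} → q z ≡ y → z ≡ p y
      moved {z = z} qz≡y = trans (≡.sym (strictlyInverseˡ ρ z)) (cong p qz≡y)

    degree₁-invariant : Invariant Degree₁
    degree₁-invariant (y , xy , only) = p y , preserve xy , λ z pxz → moved (only (q z) (reflect pxz))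

    degree₂-invariant : Invariant Degree₂
    degree₂-invariant (y , z , y≢z , xy , xz , only) =
      p y , p z , y≢z ∘ p-injective , preserve xy , preserve xz ,
      λ w pxw → Sum.map moved moved (only (q w) (reflect pxw))

    neighbours-invariant : ∀ {Q} → Invariant Q → Invariant (λ x → ∀ y → x ∼ y → Q y)
    neighbours-invariant {Q} inv all y pxy = subst Q (strictlyInverseˡ ρ y) (inv (all (q y) (reflect pxy)))

    unique-fixed : ∀ {Q y} → Invariant Q → Q y → (∀ w → Q w → w ≡ y) → Fixed y
    unique-fixed inv Qy only = only _ (inv Qy)

    neighbour-fixed : ∀ {Q x y} → Invariant Q → Fixed x → x ∼ y → Q y →
                      (∀ w → x ∼ w → Q w → w ≡ y ⊎ Fixed w) → Fixed y
    neighbour-fixed {y = y} inv px≡x xy Qy others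
      with others (p y) (subst (_∼ p y) px≡x (preserve xy)) (inv Qy)
    ... | inj₁ py≡y  = py≡y
    ... | inj₂ ppy≡py = p-injective ppy≡py

    last-neighbour-fixed : ∀ {x y} → Fixed x → x ∼ y → (∀ w → x ∼ w → w ≡ y ⊎ Fixed w) → Fixed y
    last-neighbour-fixed px≡x xy others =
      neighbour-fixed {Q = λ _ → ⊤} (λ _ → tt) px≡x xy tt (λ w xw _ → others w xw)

-- The red graph for |G| = N = 4 + n₀ and |H| = N + k; its largest index
-- L = N - 1 is at least 3, which keeps A₁, A₂, A_L and B_{L-1} distinct.
module RedGraph (n₀ k : ℕ) where

  N L : ℕ
  N = 4 + n₀
  L = 3 + n₀

  -- Vertices A i, B j, C t of the join (the bound is irrelevant, so a vertex
  -- is determined by its kind and index).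
  data V : Set where
    A : (i : ℕ) → .(i < N) → V
    B : (j : ℕ) → .(j < N) → V
    C : (t : ℕ) → .(t < k) → V

  -- Red edges between A i and B j: the path A₀ B₀ A₁ … B_{L-1} A_L, closed
  -- off by B_L, which is joined to A₁, A₂ and A_L.
  data Rung : ℕ → ℕ → Set where
    diag  : ∀ {i} → Rung i i
    step  : ∀ {j} → Rung (suc j) j
    wrap₁ : Rung 1 L
    wrap₂ : Rung 2 L

  _∼_ : V → V → Set
  A i _ ∼ B j _ = Rung i j
  B j _ ∼ A i _ = Rung i j
  A i _ ∼ C t _ = i ≡ t
  C t _ ∼ A i _ = i ≡ t
  _     ∼ _     = ⊥

  ∼-sym : ∀ {x y} → x ∼ y → y ∼ x
  ∼-sym {A _ _} {B _ _} r = r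
  ∼-sym {B _ _} {A _ _} r = r
  ∼-sym {A _ _} {C _ _} r = r
  ∼-sym {C _ _} {A _ _} r = r

  ∼-irrefl : ∀ {x} → ¬ x ∼ x
  ∼-irrefl {A _ _} ()
  ∼-irrefl {B _ _} ()
  ∼-irrefl {C _ _} ()

  rung? : ∀ i j → Dec (Rung i j)
  rung? i j with i ≟ j | i ≟ suc j
  ... | yes refl | _        = yes diag
  ... | no _     | yes refl = yes step
  ... | no i≢j   | no i≢sj with j ≟ L | i ≟ 1 | i ≟ 2
  ...   | yes refl | yes refl | _        = yes wrap₁
  ...   | yes refl | no _     | yes refl = yes wrap₂
  ...   | yes refl | no i≢1   | no i≢2   =
          no λ { diag → i≢j refl ; step → i≢sj refl ; wrap₁ → i≢1 refl ; wrap₂ → i≢2 refl }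
  ...   | no j≢L   | _        | _        =
          no λ { diag → i≢j refl ; step → i≢sj refl ; wrap₁ → j≢L refl ; wrap₂ → j≢L refl }

  _∼?_ : ∀ x y → Dec (x ∼ y)
  A i _ ∼? B j _ = rung? i j
  B j _ ∼? A i _ = rung? i j
  A i _ ∼? C t _ = i ≟ t
  C t _ ∼? A i _ = i ≟ t
  A _ _ ∼? A _ _ = no λ ()
  B _ _ ∼? B _ _ = no λ ()
  B _ _ ∼? C _ _ = no λ ()
  C _ _ ∼? B _ _ = no λ ()
  C _ _ ∼? C _ _ = no λ ()

  vertex : Fin (N + (N + k)) → V
  vertex u = [ (λ i → A (toℕ i) (toℕ<n i))
             , [ (λ j → B (toℕ j) (toℕ<n j)) , (λ t → C (toℕ t) (toℕ<n t)) ]′ ∘ splitAt N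
             ]′ (splitAt N u)

  index : V → Fin (N + (N + k))
  index (A i h) = fromℕ< h ↑ˡ (N + k)
  index (B j h) = N ↑ʳ (fromℕ< h ↑ˡ k)
  index (C t h) = N ↑ʳ (N ↑ʳ fromℕ< h)

  A-cong : ∀ {i i′} .{h h′} → i ≡ i′ → A i h ≡ A i′ h′
  A-cong refl = refl

  B-cong : ∀ {j j′} .{h h′} → j ≡ j′ → B j h ≡ B j′ h′
  B-cong refl = refl

  C-cong : ∀ {t t′} .{h h′} → t ≡ t′ → C t h ≡ C t′ h′
  C-cong refl = refl

  vertex-index : ∀ x → vertex (index x) ≡ x
  vertex-index (A i h) rewrite splitAt-↑ˡ N (fromℕ< h) (N + k) = A-cong (toℕ-fromℕ< h)
  vertex-index (B j h) rewrite splitAt-↑ʳ N (N + k) (fromℕ< h ↑ˡ k) | splitAt-↑ˡ N (fromℕ< h) k =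
    B-cong (toℕ-fromℕ< h)
  vertex-index (C t h) rewrite splitAt-↑ʳ N (N + k) (N ↑ʳ fromℕ< h) | splitAt-↑ʳ N k (fromℕ< h) =
    C-cong (toℕ-fromℕ< h)

  index-vertex : ∀ u → index (vertex u) ≡ u
  index-vertex u with splitAt N u in split
  ... | inj₁ i = trans (cong (_↑ˡ (N + k)) (fromℕ<-toℕ i _)) (splitAt⁻¹-↑ˡ split)
  ... | inj₂ v with splitAt N v in split′
  ...   | inj₁ j = trans (cong (λ w → N ↑ʳ (w ↑ˡ k)) (fromℕ<-toℕ j _))
                     (trans (cong (N ↑ʳ_) (splitAt⁻¹-↑ˡ split′)) (splitAt⁻¹-↑ʳ split))
  ...   | inj₂ t = trans (cong (λ w → N ↑ʳ (N ↑ʳ w)) (fromℕ<-toℕ t _))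
                     (trans (cong (N ↑ʳ_) (splitAt⁻¹-↑ʳ split′)) (splitAt⁻¹-↑ʳ split))

  ι : Fin (N + (N + k)) ↔ V
  ι = mk↔ₛ′ vertex index vertex-index index-vertex

  -- Red edges join G to H, so they are edges of every join G + H.
  red⊆join : (G : Graph N) (H : Graph (N + k)) → ∀ u v → vertex u ∼ vertex v → Edge (join G H) u v
  red⊆join G H u v uv with splitAt N u | splitAt N v
  ... | inj₁ _ | inj₂ _ = refl
  ... | inj₂ _ | inj₁ _ = refl
  ... | inj₁ _ | inj₁ _ = ⊥-elim uv
  ... | inj₂ u′ | inj₂ v′ with splitAt N u′ | splitAt N v′
  ...   | inj₁ _ | inj₁ _ = ⊥-elim uv
  ...   | inj₁ _ | inj₂ _ = ⊥-elim uv
  ...   | inj₂ _ | inj₁ _ = ⊥-elim uv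
  ...   | inj₂ _ | inj₂ _ = ⊥-elim uv

  0<N : 0 < N
  0<N = z<s

  1<N : 1 < N
  1<N = s≤s z<s

  2<N : 2 < N
  2<N = s≤s (s≤s z<s)

  L<N : L < N
  L<N = n<1+n L

  below-last : ∀ {j} → j < N → j ≢ L → suc j < N
  below-last j<N j≢L = ≤∧≢⇒< j<N (j≢L ∘ cong pred)

  beyond-last : ∀ {X : Set} → .(suc L < N) → X
  beyond-last h = Irrelevant.⊥-elim (<-irrefl refl h)

  absent-C : ∀ {X : Set} {t} → ¬ 0 < k → .(t < k) → X
  absent-C ¬0<k h = Irrelevant.⊥-elim (¬0<k (≤-trans (s≤s z≤n) h))

  -- First an anchor is located by degrees: C₀ if k > 0, else A₀; either way
  -- A₀ is fixed.  Then the path A₀ B₀ A₁ … A_L is fixed vertex by vertex,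
  -- B_i being the degree-2 neighbour of A_i other than B_{i-1}, and A_{i+1}
  -- the neighbour of B_i other than A_i.  Finally C_t is the unique leaf at
  -- A_t, and B_L the last unfixed neighbour of A_L.
  module Rigidity (k≤N : k ≤ N) (ρ : V ↔ V) (automorphism : IsAutomorphism _∼_ ρ) where
    open Degrees _∼_
    open Invariance ρ automorphism

    C-degree₁ : ∀ t .(h : t < k) → Degree₁ (C t h)
    C-degree₁ t h = A t (≤-trans h k≤N) , refl , λ { (A _ _) refl → refl ; (B _ _) () ; (C _ _) () }

    A-suc-¬degree₁ : ∀ i .(h : suc i < N) → ¬ Degree₁ (A (suc i) h)
    A-suc-¬degree₁ i h = two⇒¬degree₁ {a = B i (<⇒≤ h)} {b = B (suc i) h} step diag (λ ())

    B-¬degree₁ : ∀ j .(h : j < N) → ¬ Degree₁ (B j h)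
    B-¬degree₁ j h with j ≟ L
    ... | yes refl = two⇒¬degree₁ {a = A 1 1<N} {b = A 2 2<N} wrap₁ wrap₂ (λ ())
    ... | no j≢L   = two⇒¬degree₁ {a = A j h} {b = A (suc j) (below-last h j≢L)} diag step (λ ())

    B-degree₂ : ∀ j .(h : suc j < N) → Degree₂ (B j (<⇒≤ h))
    B-degree₂ j h = A j (<⇒≤ h) , A (suc j) h , (λ ()) , diag , step , λ
      { (A _ _) diag → inj₁ refl ; (A _ _) step → inj₂ refl
      ; (A _ _) wrap₁ → beyond-last h ; (A _ _) wrap₂ → beyond-last h
      ; (B _ _) () ; (C _ _) () }

    B-last-¬degree₂ : ¬ Degree₂ (B L L<N)
    B-last-¬degree₂ = three⇒¬degree₂ {a = A 1 1<N} {b = A 2 2<N} {c = A L L<N}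
                        wrap₁ wrap₂ diag (λ ()) (λ ()) (λ ())

    Anchor : V → Set
    Anchor x = Degree₁ x × (∀ y → x ∼ y → Degree₂ y)

    anchor-invariant : Invariant Anchor
    anchor-invariant (d₁ , neighbours) =
      degree₁-invariant d₁ , neighbours-invariant degree₂-invariant neighbours

    A₀-fixed-without-C : ¬ 0 < k → Fixed (A 0 0<N)
    A₀-fixed-without-C ¬0<k = unique-fixed anchor-invariant anchor only-anchor
      where
        anchor : Anchor (A 0 0<N)
        anchor = (B 0 0<N , diag , λ { (B _ _) diag → refl ; (C _ h) _ → absent-C ¬0<k h ; (A _ _) () })
               , λ { (B _ _) diag → B-degree₂ 0 1<N ; (C _ h) _ → absent-C ¬0<k h ; (A _ _) () }

        only-anchor : ∀ w → Anchor w → w ≡ A 0 0<N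
        only-anchor (A zero _)    _        = refl
        only-anchor (A (suc i) h) (d₁ , _) = ⊥-elim (A-suc-¬degree₁ i h d₁)
        only-anchor (B j h)       (d₁ , _) = ⊥-elim (B-¬degree₁ j h d₁)
        only-anchor (C _ h)       _        = absent-C ¬0<k h

    -- With pendant vertices C₀ is the only anchor, and A₀ its neighbour:
    -- A₀ has the two neighbours B₀ and C₀, while A_{t+1} has three.
    A₀-fixed-with-C : 0 < k → Fixed (A 0 0<N)
    A₀-fixed-with-C 0<k = last-neighbour-fixed C₀-fixed refl
                            λ { (A _ _) refl → inj₁ refl ; (B _ _) () ; (C _ _) () }
      where
        A₀-degree₂ : Degree₂ (A 0 0<N)
        A₀-degree₂ = B 0 0<N , C 0 0<k , (λ ()) , diag , refl ,
                     λ { (B _ _) diag → inj₁ refl ; (C _ _) refl → inj₂ refl ; (A _ _) () }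

        anchor : Anchor (C 0 0<k)
        anchor = C-degree₁ 0 0<k , λ { (A _ _) refl → A₀-degree₂ ; (B _ _) () ; (C _ _) () }

        only-anchor : ∀ w → Anchor w → w ≡ C 0 0<k
        only-anchor (A zero _)    (d₁ , _) =
          ⊥-elim (two⇒¬degree₁ {a = B 0 0<N} {b = C 0 0<k} diag refl (λ ()) d₁)
        only-anchor (A (suc i) h) (d₁ , _) = ⊥-elim (A-suc-¬degree₁ i h d₁)
        only-anchor (B j h)       (d₁ , _) = ⊥-elim (B-¬degree₁ j h d₁)
        only-anchor (C zero _)    _        = refl
        only-anchor (C (suc t) h) (_ , neighbours) =
          ⊥-elim (three⇒¬degree₂ {a = B t (<⇒≤ (≤-trans h k≤N))} {b = B (suc t) (≤-trans h k≤N)}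
                    {c = C (suc t) h} step diag refl (λ ()) (λ ()) (λ ())
                    (neighbours (A (suc t) (≤-trans h k≤N)) refl))

        C₀-fixed : Fixed (C 0 0<k)
        C₀-fixed = unique-fixed anchor-invariant anchor only-anchor

    A₀-fixed : Fixed (A 0 0<N)
    A₀-fixed with 0 <? k
    ... | yes 0<k = A₀-fixed-with-C 0<k
    ... | no ¬0<k = A₀-fixed-without-C ¬0<k

    mutual
      A-fixed : ∀ i .(h : i < N) → Fixed (A i h)
      A-fixed zero    _ = A₀-fixed
      A-fixed (suc i) h = last-neighbour-fixed (B-fixed i h) step (B-neighbours-fixed i h)

      B-fixed : ∀ j .(h : suc j < N) → Fixed (B j (<⇒≤ h))
      B-fixed j h = neighbour-fixed degree₂-invariant (A-fixed j (<⇒≤ h)) diag (B-degree₂ j h)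
                      (A-degree₂-neighbours-fixed j h)

      B-neighbours-fixed : ∀ i .(h : suc i < N) w → B i (<⇒≤ h) ∼ w → w ≡ A (suc i) h ⊎ Fixed w
      B-neighbours-fixed i h (A _ _) diag  = inj₂ (A-fixed i (<⇒≤ h))
      B-neighbours-fixed i h (A _ _) step  = inj₁ refl
      B-neighbours-fixed i h (A _ _) wrap₁ = beyond-last h
      B-neighbours-fixed i h (A _ _) wrap₂ = beyond-last h

      A-degree₂-neighbours-fixed : ∀ j .(h : suc j < N) w → A j (<⇒≤ h) ∼ w → Degree₂ w →
                                   w ≡ B j (<⇒≤ h) ⊎ Fixed w
      A-degree₂-neighbours-fixed j       h (B _ _) diag  _  = inj₁ refl
      A-degree₂-neighbours-fixed (suc j) h (B _ _) step  _  = inj₂ (B-fixed j (<⇒≤ h))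
      A-degree₂-neighbours-fixed j       h (B _ _) wrap₁ d₂ = ⊥-elim (B-last-¬degree₂ d₂)
      A-degree₂-neighbours-fixed j       h (B _ _) wrap₂ d₂ = ⊥-elim (B-last-¬degree₂ d₂)
      A-degree₂-neighbours-fixed j       h (C t h′) refl d₂ = ⊥-elim (degree₁⇒¬degree₂ (C-degree₁ t h′) d₂)

    C-fixed : ∀ t .(h : t < k) → Fixed (C t h)
    C-fixed t h = neighbour-fixed degree₁-invariant (A-fixed t (≤-trans h k≤N)) refl (C-degree₁ t h) others
      where
        others : ∀ w → A t (≤-trans h k≤N) ∼ w → Degree₁ w → w ≡ C t h ⊎ Fixed w
        others (C _ _) refl _  = inj₁ refl
        others (B j h′) _   d₁ = ⊥-elim (B-¬degree₁ j h′ d₁)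

    B-last-fixed : Fixed (B L L<N)
    B-last-fixed = last-neighbour-fixed (A-fixed L L<N) diag
      λ { (B _ _) diag → inj₁ refl ; (B _ _) step → inj₂ (B-fixed _ L<N)
        ; (C t h) refl → inj₂ (C-fixed t h) ; (A _ _) () }

    all-fixed : ∀ x → Fixed x
    all-fixed (A i h) = A-fixed i h
    all-fixed (B j h) with j ≟ L
    ... | yes refl = B-last-fixed
    ... | no j≢L   = B-fixed j (below-last h j≢L)
    all-fixed (C t h) = C-fixed t h

  rigid : k ≤ N → Rigid _∼_
  rigid k≤N ρ automorphism = Rigidity.all-fixed k≤N ρ automorphism

  join-D′≤2 : k ≤ N → (G : Graph N) (H : Graph (N + k)) → DistIndex≤ (join G H) 2
  join-D′≤2 k≤N G H = asymmetric-subgraph⇒D′≤2 (join G H) graph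
      (λ u v uv → red⊆join G H u v (edge-sound {u} {v} uv)) (rigid⇒asymmetric (rigid k≤N))
    where open Pullback ι ∼-sym ∼-irrefl _∼?_

theorem3p4 : (n m : ℕ) → 4 ≤ n → n ≤ m → m ≤ 2 * n →
    (G : Graph n) → (H : Graph m) →
    DistIndex≤ (join G H) 2
theorem3p4 n@(suc (suc (suc (suc n₀)))) m (s≤s (s≤s (s≤s (s≤s _)))) n≤m m≤2n G H
  with m≤n⇒∃[o]m+o≡n n≤m
... | k , refl = RedGraph.join-D′≤2 n₀ k k≤n G H
  where
    k≤n : k ≤ n
    k≤n = subst (k ≤_) (+-identityʳ n) (+-cancelˡ-≤ n k (n + 0) m≤2n)
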